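{- Let $k\geq 1$ and let $G$ be a $2k$-ordered simple graph on $n\geq 2k$ vertices. Then the diameter $d$ of $G$ satisfies $d\leq \left\lfloor \frac{n-3}{2k}\right\rfloor+2$.
   Context: A simple graph $G$ is $r$-ordered if, for every sequence $v_1, \ldots, v_r$ of $r$ distinct vertices of $G$, there exists a cycle in $G$ containing $v_1, \ldots, v_r$ in this (cyclic) order. -}

module Defs where

open import Data.Nat as ℕ using (ℕ; _≤_; _<_)
open import Data.Integer as ℤ using (ℤ; +_)
open import Data.Fin as Fin using (Fin; zero; suc; inject₁; fromℕ)
open import Data.Product using (Σ; _×_; ∃; _,_)
open import Relation.Nullary using (¬_)
open import Relation.Binary.PropositionalEquality using (_≡_)
open import Function.Definitions using (Injective)

record SimpleGraph (n : ℕ) : Set₁ where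
  field
    Adj     : Fin n → Fin n → Set
    sym     : ∀ {u v} → Adj u v → Adj v u
    irrefl  : ∀ {v} → ¬ Adj v v
open SimpleGraph public

module _ {n : ℕ} (G : SimpleGraph n) where

  data Walk : Fin n → Fin n → ℕ → Set where
    nil  : ∀ {u} → Walk u u 0
    cons : ∀ {u w v ℓ} → Adj G u w → Walk w v ℓ → Walk u v (ℕ.suc ℓ)

  -- dist(u,v) ≤ D  (distance = length of a shortest u–v walk/path).
  -- (The bound D is an integer, as the paper's bound ⌊(n-3)/2k⌋+2 is.)
  DistAtMost : Fin n → Fin n → ℤ → Set
  DistAtMost u v D = Σ ℕ λ ℓ → (+ ℓ) ℤ.≤ D × Walk u v ℓ

  DiameterAtMost : ℤ → Set
  DiameterAtMost D = ∀ u v → DistAtMost u v D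

  record Cycle : Set where
    field
      len₋₁    : ℕ
      vert     : Fin (ℕ.suc len₋₁) → Fin n
      long     : 3 ≤ ℕ.suc len₋₁
      distinct : Injective _≡_ _≡_ vert
      step     : ∀ (i : Fin len₋₁) → Adj G (vert (inject₁ i)) (vert (suc i))
      close    : Adj G (vert (fromℕ len₋₁)) (vert zero)
  open Cycle public

  -- The cycle C contains v₁,…,v_r in this cyclic order: they occur at
  -- strictly increasing positions of some listing of C (every rotation
  -- and reversal of a cycle is again a Cycle, so this is the cyclic order).
  ContainsInOrder : (C : Cycle) {r : ℕ} → (Fin r → Fin n) → Set
  ContainsInOrder C {r} v =
    Σ (Fin r → Fin (ℕ.suc (len₋₁ C))) λ pos →
      (∀ i j → i Fin.< j → pos i Fin.< pos j) × (∀ i → vert C (pos i) ≡ v i)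

  Ordered : ℕ → Set
  Ordered r = ∀ (v : Fin r → Fin n) → Injective _≡_ _≡_ v →
              Σ Cycle λ C → ContainsInOrder C v

-- Fix u ≠ v and q = ⌊(n − 3)/2k⌋. Greedily pick distinct neighbours a₁, …, a_{k−1} of u and
-- b₁, …, b_{k−1} of v, all different from u and v, and take a cycle through
-- a_{k−1}, b_{k−1}, …, a₁, b₁, u, v in this cyclic order. Its arc from u to v is a u–v walk; an arc
-- of length ℓ from v to a_{k−1} gives a u–v walk of length ℓ + 1, and one of length ℓ between any
-- other two consecutive listed vertices gives a u–v walk of length ℓ + 2. If all these walks were
-- longer than q + 2, the 2k arcs would add up to at least 2k(q + 1) + 3 > n, more than the cycle's length.
module Submission where

open import Defs

module OrderedGraphs where

  open import Data.Nat
    using (ℕ; zero; suc; _+_; _*_; _∸_; _/_; _%_; _≤_; _<_; _≤′_; ≤′-refl; ≤′-step; z≤n; s≤s; z<s; s<s; _≤?_; NonZero)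
  open import Data.Nat.Properties
  open import Data.Nat.DivMod using (m≡m%n+[m/n]*n; m%n<n)
  open import Data.Nat.Tactic.RingSolver using (solve-∀)
  open import Data.Fin as Fin using (Fin; zero; suc; toℕ; inject₁; fromℕ; lower₁; punchIn; punchOut)
  open import Data.Fin.Properties as Finₚ
    using (toℕ-fromℕ; toℕ≤pred[n]; ≤fromℕ; toℕ-lower₁; inject₁-lower₁; ≤̄⇒inject₁<; injective⇒≤;
           punchIn-injective; punchInᵢ≢i; punchIn-punchOut; all?; any?; ¬∀⟶∃¬)
  import Data.Integer as ℤ
  open import Data.Product using (Σ; ∃; _×_; _,_; proj₁; proj₂)
  open import Data.Sum using (_⊎_; inj₁; inj₂)
  open import Data.Vec.Functional using (Vector; []; _∷_)
  open import Function using (_∘_)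
  open import Function.Definitions using (Injective)
  open import Relation.Nullary using (¬_; yes; no; contradiction)
  open import Relation.Binary.PropositionalEquality as ≡ using (_≡_; _≢_; refl; trans; cong; subst)

  private
    variable
      A : Set
      m r l l′ D D′ : ℕ

  m∸n≤o⊎n+o<m : ∀ m n o → m ∸ n ≤ o ⊎ n + o < m
  m∸n≤o⊎n+o<m m n o with m ≤? n + o
  ... | yes m≤n+o = inj₁ (m≤n+o⇒m∸n≤o m n m≤n+o)
  ... | no  m≰n+o = inj₂ (≰⇒> m≰n+o)

  m<[1+m/n]*n : ∀ m n .{{_ : NonZero n}} → m < suc (m / n) * n
  m<[1+m/n]*n m n = begin-strict
    m                  ≡⟨ m≡m%n+[m/n]*n m n ⟩
    m % n + m / n * n  <⟨ +-monoˡ-< (m / n * n) (m%n<n m n) ⟩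
    n + m / n * n      ∎
    where open ≤-Reasoning

  small-gap-or-spread : ∀ c (p : Fin (suc m) → ℕ) →
    (∃ λ i → p (suc i) ∸ p (inject₁ i) ≤ c) ⊎ p zero + m * suc c ≤ p (fromℕ m)
  small-gap-or-spread {zero} c p = inj₂ (≤-reflexive (+-identityʳ (p zero)))
  small-gap-or-spread {suc m} c p with m∸n≤o⊎n+o<m (p (suc zero)) (p zero) c | small-gap-or-spread c (p ∘ suc)
  ... | inj₁ small | _                = inj₁ (zero , small)
  ... | inj₂ _     | inj₁ (i , small) = inj₁ (suc i , small)
  ... | inj₂ gap   | inj₂ spread      = inj₂ (begin
    p zero + (suc c + m * suc c)  ≡⟨ +-assoc (p zero) (suc c) (m * suc c) ⟨
    p zero + suc c + m * suc c    ≡⟨ cong (_+ m * suc c) (+-suc (p zero) c) ⟩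
    suc (p zero + c) + m * suc c  ≤⟨ +-monoˡ-≤ (m * suc c) gap ⟩
    p (suc zero) + m * suc c      ≤⟨ spread ⟩
    p (fromℕ (suc m))             ∎)
    where open ≤-Reasoning

  _∈_ : A → Vector A m → Set
  x ∈ xs = ∃ λ i → xs i ≡ x

  _∉_ : A → Vector A m → Set
  x ∉ xs = ¬ x ∈ xs

  ∷-injective : ∀ {x} {xs : Vector A m} → x ∉ xs → Injective _≡_ _≡_ xs →
                Injective _≡_ _≡_ (x ∷ xs)
  ∷-injective x∉xs xs-inj {zero}  {zero}  _  = refl
  ∷-injective x∉xs xs-inj {zero}  {suc j} eq = contradiction (j , ≡.sym eq) x∉xs
  ∷-injective x∉xs xs-inj {suc i} {zero}  eq = contradiction (i , eq) x∉xs
  ∷-injective x∉xs xs-inj {suc i} {suc j} eq = cong suc (xs-inj eq)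

  fresh-element : ∀ {n} → m < n → (f : Vector (Fin n) m) → ∃ λ y → y ∉ f
  fresh-element {n = n} m<n f with all? (λ y → any? (λ i → f i Finₚ.≟ y))
  ... | yes covered = contradiction (injective⇒≤ preimage-injective) (<⇒≱ m<n)
    where
      preimage-injective : Injective _≡_ _≡_ (proj₁ ∘ covered)
      preimage-injective {y} {y′} eq =
        trans (≡.sym (proj₂ (covered y))) (trans (cong f eq) (proj₂ (covered y′)))
  ... | no ¬covered = ¬∀⟶∃¬ n _ (λ y → any? (λ i → f i Finₚ.≟ y)) ¬covered

  module _ {n : ℕ} (G : SimpleGraph n) where

    private
      variable
        x y z : Fin n

    adj⇒≢ : Adj G x y → x ≢ y
    adj⇒≢ x~y refl = irrefl G x~y

    _++ᵂ_ : Walk G x y l → Walk G y z l′ → Walk G x z (l + l′)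
    nil      ++ᵂ w′ = w′
    cons e w ++ᵂ w′ = cons e (w ++ᵂ w′)

    _∷ʳᵂ_ : Walk G x y l → Adj G y z → Walk G x z (suc l)
    nil      ∷ʳᵂ e′ = cons e′ nil
    cons e w ∷ʳᵂ e′ = cons e (w ∷ʳᵂ e′)

    reverseᵂ : Walk G x y l → Walk G y x l
    reverseᵂ nil        = nil
    reverseᵂ (cons e w) = reverseᵂ w ∷ʳᵂ sym G e

    substᵂ : ∀ {x′ y′} → x ≡ x′ → y ≡ y′ → l ≡ l′ → Walk G x y l → Walk G x′ y′ l′
    substᵂ refl refl refl w = w

    DistAtMostℕ : Fin n → Fin n → ℕ → Set
    DistAtMostℕ x y D = Σ ℕ λ l → l ≤ D × Walk G x y l

    dist-refl : DistAtMostℕ x x 0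
    dist-refl = 0 , z≤n , nil

    walk⇒dist : Walk G x y l → DistAtMostℕ x y l
    walk⇒dist w = _ , ≤-refl , w

    adj⇒dist : Adj G x y → DistAtMostℕ x y 1
    adj⇒dist e = walk⇒dist (cons e nil)

    dist-mono : D ≤ D′ → DistAtMostℕ x y D → DistAtMostℕ x y D′
    dist-mono D≤D′ (l , l≤D , w) = l , ≤-trans l≤D D≤D′ , w

    dist-sym : DistAtMostℕ x y D → DistAtMostℕ y x D
    dist-sym (l , l≤D , w) = l , l≤D , reverseᵂ w

    dist-trans : DistAtMostℕ x y D → DistAtMostℕ y z D′ → DistAtMostℕ x z (D + D′)
    dist-trans (l , l≤D , w) (l′ , l′≤D′ , w′) = l + l′ , +-mono-≤ l≤D l′≤D′ , w ++ᵂ w′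

    segment : (f : Vector (Fin n) (suc m)) → (∀ i → Adj G (f (inject₁ i)) (f (suc i))) →
              ∀ {i j} → i Fin.≤ j → Walk G (f i) (f j) (toℕ j ∸ toℕ i)
    segment f f-step {zero}  {zero}  _ = nil
    segment {suc m} f f-step {zero}  {suc j} _ =
      cons (f-step zero) (segment (f ∘ suc) (f-step ∘ suc) {zero} {j} z≤n)
    segment {suc m} f f-step {suc i} {suc j} (s≤s i≤j) = segment (f ∘ suc) (f-step ∘ suc) i≤j

    module _ (C : Cycle G) where

      private
        len = len₋₁ C

      cycle-length≤n : suc len ≤ n
      cycle-length≤n = injective⇒≤ (distinct C)

      arc : {i j : Fin (suc len)} → i Fin.≤ j → Walk G (vert C i) (vert C j) (toℕ j ∸ toℕ i)
      arc = segment (vert C) (step C)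

      arc-around : (i j : Fin (suc len)) → Walk G (vert C j) (vert C i) (suc len + toℕ i ∸ toℕ j)
      arc-around i j = substᵂ refl refl length (arc (≤fromℕ j) ++ᵂ cons (close C) (arc {i = zero} z≤n))
        where
          j≤len : toℕ j ≤ len
          j≤len = toℕ≤pred[n] j
          length : toℕ (fromℕ len) ∸ toℕ j + suc (toℕ i) ≡ suc len + toℕ i ∸ toℕ j
          length = begin
            toℕ (fromℕ len) ∸ toℕ j + suc (toℕ i)  ≡⟨ cong (λ t → t ∸ toℕ j + suc (toℕ i)) (toℕ-fromℕ _) ⟩
            len ∸ toℕ j + suc (toℕ i)              ≡⟨ +-suc (len ∸ toℕ j) (toℕ i) ⟩
            suc (len ∸ toℕ j) + toℕ i              ≡⟨ cong (_+ toℕ i) (+-∸-assoc 1 j≤len) ⟨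
            suc len ∸ toℕ j + toℕ i                ≡⟨ +-∸-comm (toℕ i) (m≤n⇒m≤1+n j≤len) ⟨
            suc len + toℕ i ∸ toℕ j                ∎
            where open ≡.≡-Reasoning

      cycle-successor : {i j : Fin (suc len)} → i Fin.< j →
                        ∃ λ k → toℕ k ≡ suc (toℕ i) × Adj G (vert C i) (vert C k)
      cycle-successor {i} {j} i<j =
        suc i⁻ , cong suc (toℕ-lower₁ i len≢i) ,
        subst (λ t → Adj G (vert C t) (vert C (suc i⁻))) (inject₁-lower₁ i len≢i) (step C i⁻)
        where
          len≢i : len ≢ toℕ i
          len≢i len≡i = <⇒≱ i<j (subst (toℕ j ≤_) len≡i (toℕ≤pred[n] j))
          i⁻ = lower₁ i len≢i

      consecutive-arc : {S : Vector (Fin n) (suc r)} (c : ContainsInOrder G C S) (i : Fin r) →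
                        let pos = proj₁ c in
                        Walk G (S (inject₁ i)) (S (suc i)) (toℕ (pos (suc i)) ∸ toℕ (pos (inject₁ i)))
      consecutive-arc (_ , mono , hit) i =
        substᵂ (hit (inject₁ i)) (hit (suc i)) refl (arc (<⇒≤ (mono _ _ (≤̄⇒inject₁< ≤-refl))))

      closing-arc : {S : Vector (Fin n) (suc r)} (c : ContainsInOrder G C S) →
                    let pos = proj₁ c in
                    Walk G (S (fromℕ r)) (S zero) (suc len + toℕ (pos zero) ∸ toℕ (pos (fromℕ r)))
      closing-arc (pos , _ , hit) = substᵂ (hit _) (hit zero) refl (arc-around (pos zero) (pos _))

    ordered-pred : suc m ≤ n → Ordered G (suc m) → Ordered G m
    ordered-pred m<n ord xs xs-inj with fresh-element m<n xs
    ... | y , y∉xs with ord (y ∷ xs) (∷-injective y∉xs xs-inj)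
    ...   | C , pos , mono , hit = C , pos ∘ suc , (λ i j i<j → mono (suc i) (suc j) (s≤s i<j)) , hit ∘ suc

    ordered-≤ : m ≤ r → r ≤ n → Ordered G r → Ordered G m
    ordered-≤ m≤r = go (≤⇒≤′ m≤r)
      where
        go : ∀ {m r} → m ≤′ r → r ≤ n → Ordered G r → Ordered G m
        go ≤′-refl        _   ord = ord
        go (≤′-step m≤′r) r<n ord = go m≤′r (<⇒≤ r<n) (ordered-pred r<n ord)

    ordered⇒3≤n : r ≤ n → Ordered G r → 3 ≤ n
    ordered⇒3≤n r≤n ord with ordered-≤ z≤n r≤n ord [] (λ { {()} })
    ... | C , _ = ≤-trans (long C) (cycle-length≤n C)

    -- List x, then a fresh vertex y, then E: the successor of x on the cycle comes no later than y,
    -- hence before every vertex of E.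
    neighbour-avoiding : suc (suc m) ≤ n → Ordered G (suc (suc m)) → (E : Vector (Fin n) m) →
                         Injective _≡_ _≡_ E → x ∉ E → ∃ λ w → Adj G x w × w ∉ E
    neighbour-avoiding {x = x} 2+m≤n ord E E-inj x∉E with fresh-element 2+m≤n (x ∷ E)
    ... | y , y∉xE with ord (x ∷ y ∷ E) (∷-injective x∉yE (∷-injective y∉E E-inj))
      where
        y∉E : y ∉ E
        y∉E (i , Ei≡y) = y∉xE (suc i , Ei≡y)
        x∉yE : x ∉ (y ∷ E)
        x∉yE (zero  , y≡x)  = y∉xE (zero , ≡.sym y≡x)
        x∉yE (suc i , Ei≡x) = x∉E (i , Ei≡x)
    ... | C , pos , mono , hit with cycle-successor C (mono zero (suc zero) z<s)
    ...   | k , k≡1+pos₀ , pos₀~k = w , subst (λ t → Adj G t w) (hit zero) pos₀~k , w∉E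
      where
        w = vert C k
        w∉E : w ∉ E
        w∉E (i , Ei≡w) = <⇒≢ pos₀<posᵢ (trans (≡.sym k≡1+pos₀) (cong toℕ (≡.sym posᵢ≡k)))
          where
            pos₀<posᵢ = ≤-<-trans (mono zero (suc zero) z<s) (mono (suc zero) (suc (suc i)) (s<s z<s))
            posᵢ≡k = distinct C (trans (hit (suc (suc i))) Ei≡w)

    neighbour-outside : suc (suc m) ≤ n → Ordered G (suc (suc m)) → (S : Vector (Fin n) (suc m)) →
                        Injective _≡_ _≡_ S → x ∈ S → ∃ λ w → Adj G x w × w ∉ S
    neighbour-outside {x = x} 2+m≤n ord S S-inj (i , Si≡x)
      with neighbour-avoiding 2+m≤n ord (S ∘ punchIn i) (punchIn-injective i _ _ ∘ S-inj) x∉rest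
      where
        x∉rest : x ∉ (S ∘ punchIn i)
        x∉rest (j , eq) = punchInᵢ≢i i j (S-inj (trans eq (≡.sym Si≡x)))
    ... | w , x~w , w∉rest = w , x~w , w∉S
      where
        w∉S : w ∉ S
        w∉S (j , Sj≡w) with i Finₚ.≟ j
        ... | yes refl = adj⇒≢ x~w (trans (≡.sym Si≡x) Sj≡w)
        ... | no  i≢j  = w∉rest (punchOut i≢j , trans (cong S (punchIn-punchOut i≢j)) Sj≡w)

    diameter-ℕ⇒ℤ : (∀ u v → DistAtMostℕ u v D) → DiameterAtMost G (ℤ.+ D)
    diameter-ℕ⇒ℤ diam u v with diam u v
    ... | l , l≤D , w = l , ℤ.+≤+ l≤D , w

    module _ (u v : Fin n) where

      NearU : Fin n → Set
      NearU x = DistAtMostℕ u x 1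

      NearV : Fin n → Set
      NearV y = DistAtMostℕ y v 1

      Bridge : Fin n → Fin n → Set
      Bridge x y = ∀ {l} → Walk G x y l → DistAtMostℕ u v (2 + l)

      bridge-UV : NearU x → NearV y → Bridge x y
      bridge-UV near-u near-v {l} w =
        dist-mono (≤-reflexive (cong suc (+-comm l 1))) (dist-trans near-u (dist-trans (walk⇒dist w) near-v))

      bridge-VU : NearV x → NearU y → Bridge x y
      bridge-VU near-v near-u w = bridge-UV near-u near-v (reverseᵂ w)

      -- S lists a_j, b_j, …, a₁, b₁, u, v with every aᵢ near u and every bᵢ near v.
      record Alternating (m : ℕ) (S : Vector (Fin n) (2 + m)) : Set where
        field
          starts-near-u : NearU (S zero)
          bridges       : (i : Fin m) → Bridge (S (inject₁ (inject₁ i))) (S (suc (inject₁ i)))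
          ends-u        : S (inject₁ (fromℕ m)) ≡ u
          ends-v        : S (suc (fromℕ m)) ≡ v

      open Alternating

      alternating-∷ : ∀ {a b} {S : Vector (Fin n) (2 + m)} → Adj G u a → Adj G v b → Alternating m S →
                      Alternating (2 + m) (a ∷ b ∷ S)
      alternating-∷ {m} {a} {b} {S} u~a v~b alt = record
        { starts-near-u = adj⇒dist u~a
        ; bridges       = bridges′
        ; ends-u        = ends-u alt
        ; ends-v        = ends-v alt
        }
        where
          b-near-v : NearV b
          b-near-v = dist-sym (adj⇒dist v~b)
          bridges′ : (i : Fin (2 + m)) →
                     Bridge ((a ∷ b ∷ S) (inject₁ (inject₁ i))) ((a ∷ b ∷ S) (suc (inject₁ i)))
          bridges′ zero          = bridge-UV (adj⇒dist u~a) b-near-v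
          bridges′ (suc zero)    = bridge-VU b-near-v (starts-near-u alt)
          bridges′ (suc (suc i)) = bridges alt i

      alternating-extend : 4 + m ≤ n → Ordered G (4 + m) → {S : Vector (Fin n) (2 + m)} →
                           Injective _≡_ _≡_ S → Alternating m S →
                           ∃ λ (S′ : Vector (Fin n) (4 + m)) → Injective _≡_ _≡_ S′ × Alternating (2 + m) S′
      alternating-extend {m} 4+m≤n ord {S} S-inj alt =
        let b , v~b , b∉S  = neighbour-outside {m = suc m} (<⇒≤ 4+m≤n) (ordered-pred 4+m≤n ord)
                                               S S-inj (_ , ends-v alt)
            a , u~a , a∉bS = neighbour-outside {m = 2 + m} 4+m≤n ord
                                               (b ∷ S) (∷-injective b∉S S-inj) (_ , ends-u alt)
        in a ∷ b ∷ S , ∷-injective a∉bS (∷-injective b∉S S-inj) , alternating-∷ u~a v~b alt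

      alternating-sequence : (k : ℕ) → 2 + k * 2 ≤ n → Ordered G (2 + k * 2) → u ≢ v →
                             ∃ λ (S : Vector (Fin n) (2 + k * 2)) → Injective _≡_ _≡_ S × Alternating (k * 2) S
      alternating-sequence zero _ _ u≢v =
        u ∷ v ∷ [] , ∷-injective u∉[v] (∷-injective (λ { (() , _) }) (λ { {()} })) , record
          { starts-near-u = dist-mono z≤n dist-refl
          ; bridges       = λ ()
          ; ends-u        = refl
          ; ends-v        = refl
          }
        where
          u∉[v] : u ∉ (v ∷ [])
          u∉[v] (zero , v≡u) = u≢v (≡.sym v≡u)
      alternating-sequence (suc k) r≤n ord u≢v =
        let S , S-inj , alt = alternating-sequence k (≤-trans (m≤n+m _ 2) r≤n)
                                                     (ordered-≤ (m≤n+m _ 2) r≤n ord) u≢v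
        in alternating-extend r≤n ord S-inj alt

      short-or-long : (q : ℕ) (C : Cycle G) {S : Vector (Fin n) (2 + m)} →
                      Alternating m S → ContainsInOrder G C S →
                      DistAtMostℕ u v (2 + q) ⊎ suc q * (2 + m) + 3 ≤ suc (len₋₁ C)
      short-or-long {m} q C alt c@(pos , _ , _)
        with m∸n≤o⊎n+o<m (toℕ (pos (suc (fromℕ m)))) (toℕ (pos (inject₁ (fromℕ m)))) (2 + q)
      ... | inj₁ uv-short =
        inj₁ (dist-mono uv-short
               (walk⇒dist (substᵂ (ends-u alt) (ends-v alt) refl (consecutive-arc C c (fromℕ m)))))
      ... | inj₂ uv-long with small-gap-or-spread q (λ i → toℕ (pos (inject₁ i)))
      ...   | inj₁ (i , gap-short) =
        inj₁ (dist-mono (+-monoʳ-≤ 2 gap-short) (bridges alt i (consecutive-arc C c (inject₁ i))))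
      ...   | inj₂ spread
        with m∸n≤o⊎n+o<m (suc (len₋₁ C) + toℕ (pos zero)) (toℕ (pos (suc (fromℕ m)))) (suc q)
      ...     | inj₁ wrap-short =
        inj₁ (dist-mono (s≤s wrap-short)
               (dist-trans (starts-near-u alt)
                 (dist-sym (walk⇒dist (substᵂ (ends-v alt) refl refl (closing-arc C c))))))
      ...     | inj₂ wrap-long = inj₂ (+-cancelʳ-≤ P₀ _ _ (begin
        suc q * (2 + m) + 3 + P₀                      ≡⟨ rearrange q m P₀ ⟩
        suc (suc (P₀ + m * suc q + (2 + q)) + suc q)  ≤⟨ s≤s (+-monoˡ-≤ (suc q) Pᵥ-large) ⟩
        suc (Pᵥ + suc q)                              ≤⟨ wrap-long ⟩
        suc (len₋₁ C) + P₀                            ∎))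
        where
          open ≤-Reasoning
          P₀ = toℕ (pos zero)
          Pᵥ = toℕ (pos (suc (fromℕ m)))
          Pᵥ-large : suc (P₀ + m * suc q + (2 + q)) ≤ Pᵥ
          Pᵥ-large = ≤-trans (s≤s (+-monoˡ-≤ (2 + q) spread)) uv-long
          rearrange : ∀ q m p → suc q * (2 + m) + 3 + p ≡ suc (suc (p + m * suc q + (2 + q)) + suc q)
          rearrange = solve-∀

      distinct⇒dist≤ : (k q : ℕ) → 2 + k * 2 ≤ n → Ordered G (2 + k * 2) →
                       n < suc q * (2 + k * 2) + 3 → u ≢ v → DistAtMostℕ u v (2 + q)
      distinct⇒dist≤ k q r≤n ord n<bound u≢v with alternating-sequence k r≤n ord u≢v
      ... | S , S-inj , alt with ord S S-inj
      ...   | C , c with short-or-long q C alt c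
      ...     | inj₁ short = short
      ...     | inj₂ long  = contradiction (≤-trans long (cycle-length≤n C)) (<⇒≱ n<bound)

    ordered⇒diameter≤ : (k : ℕ) → 2 * suc k ≤ n → Ordered G (2 * suc k) →
                        ∀ u v → DistAtMostℕ u v (2 + (n ∸ 3) / (2 * suc k))
    ordered⇒diameter≤ k r≤n ord u v with u Finₚ.≟ v
    ... | yes refl = dist-mono z≤n dist-refl
    ... | no u≢v = distinct⇒dist≤ u v k q (subst (_≤ n) r≡ r≤n) (subst (Ordered G) r≡ ord) n<bound u≢v
      where
        r≡ : 2 * suc k ≡ 2 + k * 2
        r≡ = *-comm 2 (suc k)
        q = (n ∸ 3) / (2 * suc k)
        n<bound : n < suc q * (2 + k * 2) + 3
        n<bound = begin-strict
          n                            ≡⟨ m∸n+n≡m (ordered⇒3≤n r≤n ord) ⟨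
          n ∸ 3 + 3                    <⟨ +-monoˡ-< 3 (m<[1+m/n]*n (n ∸ 3) (2 * suc k)) ⟩
          suc q * (2 * suc k) + 3      ≡⟨ cong (λ r → suc q * r + 3) r≡ ⟩
          suc q * (2 + k * 2) + 3      ∎
          where open ≤-Reasoning

  +[2+[n∸3]/r]≡[n-3]/r+2 : ∀ {n} r .{{_ : NonZero r}} → 3 ≤ n →
                           ℤ.+ (2 + (n ∸ 3) / r) ≡ (ℤ.+ n ℤ.- ℤ.+ 3) ℤ./ℕ r ℤ.+ ℤ.+ 2
  +[2+[n∸3]/r]≡[n-3]/r+2 {suc (suc (suc n))} r (s≤s (s≤s (s≤s _))) = cong ℤ.+_ (+-comm 2 (n / r))

open import Data.Nat using (ℕ; suc; _≤_; _*_; NonZero)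
open import Data.Nat.Properties using (m*n≢0)
open import Data.Integer using (ℤ; +_; _-_; _+_; _/ℕ_)
open import Relation.Binary.PropositionalEquality using (subst)
open OrderedGraphs

proposition3p1 : (k : ℕ) → .{{_ : NonZero k}} → (n : ℕ) → 2 * k ≤ n →
    (G : SimpleGraph n) → Ordered G (2 * k) →
    DiameterAtMost G ((_/ℕ_ ((+ n) - (+ 3)) (2 * k) {{m*n≢0 2 k}}) + (+ 2))
proposition3p1 (suc k) n r≤n G ord =
  subst (DiameterAtMost G) (+[2+[n∸3]/r]≡[n-3]/r+2 (2 * suc k) (ordered⇒3≤n G r≤n ord))
        (diameter-ℕ⇒ℤ G (ordered⇒diameter≤ G k r≤n ord))
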